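{- Let $n\ge 0$ and let $k,m_0,\dots,m_n\geq 2$ be integers such that $\sum_{i=0}^n\frac{1}{2s_0(km_i)}>1$, where $s_0(m)=\min\{2^{m-1},\frac12m(m-1)+\lfloor\sqrt{2m+2}\rfloor\}$. Then \[ \frac{1}{2s_0(km_i)}\leq\frac{1}{km_i}-\frac{1}{k(m_i+1)}\quad\text{for all } i\in\{0,\dots,n\},\qquad\text{and}\qquad\sum_{i=0}^n\frac{1}{km_i}>3. \] -}

module Defs where

open import Data.Nat as ℕ using (ℕ; zero; suc; _≤ᵇ_; _*_; _+_; _^_; _∸_; _⊓_; _/_)
open import Data.Bool using (if_then_else_)
open import Data.Integer using (+_)
open import Data.Rational as ℚ using (ℚ; 0ℚ)
open import Data.Fin using (Fin)

isqrtFrom : ℕ → ℕ → ℕ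
isqrtFrom zero    n = 0
isqrtFrom (suc r) n = if suc r * suc r ≤ᵇ n then suc r else isqrtFrom r n

isqrt : ℕ → ℕ
isqrt n = isqrtFrom n n

-- s₀(m) = min { 2^(m-1), m(m-1)/2 + ⌊√(2m+2)⌋ }   (m(m-1) is even, so / 2 is exact)
s0 : ℕ → ℕ
s0 m = (2 ^ (m ∸ 1)) ⊓ ((m * (m ∸ 1)) / 2 + isqrt (2 * m + 2))

-- 1/n as a rational (used only for n ≥ 1; set to 0 at n = 0)
inv : ℕ → ℚ
inv zero    = 0ℚ
inv (suc n) = + 1 ℚ./ suc n

sumFin : (n : ℕ) → (Fin n → ℚ) → ℚ
sumFin zero    f = 0ℚ
sumFin (suc n) f = f Fin.zero ℚ.+ sumFin n (λ i → f (Fin.suc i))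

-- With M = k m, the bound 2 s₀(M) ≥ M (M − 1) (valid for every M, since M² ≤ 2^M from
-- M = 4 on and M (M − 1) is even) together with m + 1 ≤ M − 1 gives 2 s₀(k m) ≥ k m (m + 1).
-- The first claim is this bound read through 1/(k m) − 1/(k (m + 1)) = 1/(k m (m + 1)); as
-- m ≥ 2 it also gives 2 s₀(k m) ≥ 3 k m, so Σ 1/(k mᵢ) ≥ 3 Σ 1/(2 s₀(k mᵢ)) > 3.
module Submission where

open import Defs
open import Data.Nat using (ℕ; suc; _*_; _+_; _≤_)
open import Data.Integer using (+_)
open import Data.Fin using (Fin)
open import Data.Product using (_×_)
open import Data.Rational using (ℚ; 1ℚ; _<_; _-_) renaming (_≤_ to _≤ℚ_; _/_ to _/ℚ_)

open import Data.Nat using (zero; _∸_; _^_; _/_; _⊓_; z≤n; s≤s)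
import Data.Nat.Properties as ℕ
open import Data.Nat.Divisibility using (_∣_; _∣0; ∣m∣n⇒∣m+n; n∣m*n)
open import Data.Nat.DivMod using (m*[n/m]≡n)
open import Data.Nat.Tactic.RingSolver using (solve-∀)
open import Data.Product using (_,_)
open import Relation.Binary.PropositionalEquality
import Data.Integer as ℤ
import Data.Integer.Properties as ℤ
import Data.Rational as ℚ
import Data.Rational.Properties as ℚ
open import Data.Rational.Unnormalised as ℚᵘ using (mkℚᵘ; _≃_)
import Data.Rational.Unnormalised.Properties as ℚᵘ

2∣n*[1+n] : ∀ n → 2 ∣ n * suc n
2∣n*[1+n] zero    = 2 ∣0
2∣n*[1+n] (suc n) = subst (2 ∣_) (expand n) (∣m∣n⇒∣m+n (2∣n*[1+n] n) (n∣m*n (suc n)))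
  where
  expand : ∀ n → n * suc n + suc n * 2 ≡ suc n * suc (suc n)
  expand = solve-∀

2∣n*[n∸1] : ∀ n → 2 ∣ n * (n ∸ 1)
2∣n*[n∸1] zero    = 2 ∣0
2∣n*[n∸1] (suc n) = subst (2 ∣_) (ℕ.*-comm n (suc n)) (2∣n*[1+n] n)

[4+j]²≤2^[4+j] : ∀ j → (4 + j) * (4 + j) ≤ 2 ^ (4 + j)
[4+j]²≤2^[4+j] zero    = ℕ.≤-refl
[4+j]²≤2^[4+j] (suc j) = begin
  (5 + j) * (5 + j)     ≤⟨ subst ((5 + j) * (5 + j) ≤_) (difference j) (ℕ.m≤m+n _ _) ⟩
  2 * ((4 + j) * (4 + j)) ≤⟨ ℕ.*-monoʳ-≤ 2 ([4+j]²≤2^[4+j] j) ⟩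
  2 * 2 ^ (4 + j)       ∎
  where
  open ℕ.≤-Reasoning
  difference : ∀ j → (5 + j) * (5 + j) + (7 + 6 * j + j * j) ≡ 2 * ((4 + j) * (4 + j))
  difference = solve-∀

n*[n∸1]≤2^n : ∀ n → n * (n ∸ 1) ≤ 2 ^ n
n*[n∸1]≤2^n 0 = z≤n
n*[n∸1]≤2^n 1 = z≤n
n*[n∸1]≤2^n 2 = ℕ.m≤m+n 2 2
n*[n∸1]≤2^n 3 = ℕ.m≤m+n 6 2
n*[n∸1]≤2^n n@(suc (suc (suc (suc j)))) =
  ℕ.≤-trans (ℕ.*-monoʳ-≤ n (ℕ.m∸n≤m n 1)) ([4+j]²≤2^[4+j] j)

n*[n∸1]≤2*s0[n] : ∀ n → n * (n ∸ 1) ≤ 2 * s0 n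
n*[n∸1]≤2*s0[n] zero    = z≤n
n*[n∸1]≤2*s0[n] n@(suc n-1) = begin
  n * (n ∸ 1)                ≤⟨ ℕ.⊓-glb viaPower viaTriangular ⟩
  (2 * 2 ^ (n ∸ 1)) ⊓ (2 * t) ≡⟨ ℕ.*-distribˡ-⊓ 2 (2 ^ (n ∸ 1)) t ⟨
  2 * s0 n                   ∎
  where
  open ℕ.≤-Reasoning
  t : ℕ
  t = n * (n ∸ 1) / 2 + isqrt (2 * n + 2)
  viaPower : n * (n ∸ 1) ≤ 2 * 2 ^ (n ∸ 1)
  viaPower = n*[n∸1]≤2^n n
  viaTriangular : n * (n ∸ 1) ≤ 2 * t
  viaTriangular = begin
    n * (n ∸ 1)                                   ≡⟨ m*[n/m]≡n (2∣n*[n∸1] n) ⟨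
    2 * (n * (n ∸ 1) / 2)                         ≤⟨ ℕ.m≤m+n _ _ ⟩
    2 * (n * (n ∸ 1) / 2) + 2 * isqrt (2 * n + 2) ≡⟨ ℕ.*-distribˡ-+ 2 (n * (n ∸ 1) / 2) (isqrt (2 * n + 2)) ⟨
    2 * t                                         ∎

m+1≤k*m∸1 : ∀ k m → 2 ≤ k → 2 ≤ m → m + 1 ≤ k * m ∸ 1
m+1≤k*m∸1 k m 2≤k 2≤m = ℕ.m+n≤o⇒m≤o∸n (m + 1) (begin
  m + 1 + 1 ≡⟨ ℕ.+-assoc m 1 1 ⟩
  m + 2     ≤⟨ ℕ.+-monoʳ-≤ m 2≤m ⟩
  m + m     ≡⟨ cong (_+_ m) (ℕ.+-identityʳ m) ⟨
  2 * m     ≤⟨ ℕ.*-monoˡ-≤ m 2≤k ⟩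
  k * m     ∎)
  where open ℕ.≤-Reasoning

k*m*[m+1]≤2*s0[k*m] : ∀ k m → 2 ≤ k → 2 ≤ m → k * m * (m + 1) ≤ 2 * s0 (k * m)
k*m*[m+1]≤2*s0[k*m] k m 2≤k 2≤m =
  ℕ.≤-trans (ℕ.*-monoʳ-≤ (k * m) (m+1≤k*m∸1 k m 2≤k 2≤m)) (n*[n∸1]≤2*s0[n] (k * m))

toℚᵘ-inv : ∀ a → ℚ.toℚᵘ (inv (suc a)) ≃ mkℚᵘ (+ 1) a
toℚᵘ-inv a = ℚ.toℚᵘ-fromℚᵘ (mkℚᵘ (+ 1) a)

mkℚᵘ-mono-≤ : ∀ x d y e → x * suc e ≤ y * suc d → mkℚᵘ (+ x) d ℚᵘ.≤ mkℚᵘ (+ y) e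
mkℚᵘ-mono-≤ x d y e x*e≤y*d =
  ℚᵘ.*≤* (subst₂ ℤ._≤_ (ℤ.pos-* x (suc e)) (ℤ.pos-* y (suc d)) (ℤ.+≤+ x*e≤y*d))

-- In ℚᵘ, inv (1 + a) is the literal fraction mkℚᵘ 1 a, so these inequalities reduce
-- to the hypothesis by cross-multiplication and a semiring identity.
inv+inv≤inv : ∀ x y z → 1 ≤ x → 1 ≤ y → 1 ≤ z →
              (x + y) * z ≤ x * y → inv x ℚ.+ inv y ≤ℚ inv z
inv+inv≤inv (suc a) (suc b) (suc c) _ _ _ [x+y]z≤xy =
  ℚ.toℚᵘ-cancel-≤ (ℚᵘ.≤-respˡ-≃ (ℚᵘ.≃-sym toℚᵘ-sum) (ℚᵘ.≤-respʳ-≃ (ℚᵘ.≃-sym (toℚᵘ-inv c))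
    (mkℚᵘ-mono-≤ _ _ _ _ (subst₂ _≤_ (lhs a b c) (rhs a b) [x+y]z≤xy))))
  where
  toℚᵘ-sum : ℚ.toℚᵘ (inv (suc a) ℚ.+ inv (suc b)) ≃ mkℚᵘ (+ 1) a ℚᵘ.+ mkℚᵘ (+ 1) b
  toℚᵘ-sum = ℚᵘ.≃-trans (ℚ.toℚᵘ-homo-+ (inv (suc a)) (inv (suc b)))
                        (ℚᵘ.+-cong (toℚᵘ-inv a) (toℚᵘ-inv b))
  lhs : ∀ a b c → (suc a + suc b) * suc c ≡ suc (b + 0 + suc (a + 0)) * suc c
  lhs = solve-∀
  rhs : ∀ a b → suc a * suc b ≡ 1 * suc (b + a * suc b)
  rhs = solve-∀

c*inv≤inv : ∀ c x z → 1 ≤ x → 1 ≤ z → c * z ≤ x → (+ c /ℚ 1) ℚ.* inv x ≤ℚ inv z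
c*inv≤inv c (suc a) (suc b) _ _ cz≤x =
  ℚ.toℚᵘ-cancel-≤ (ℚᵘ.≤-respˡ-≃ (ℚᵘ.≃-sym toℚᵘ-product) (ℚᵘ.≤-respʳ-≃ (ℚᵘ.≃-sym (toℚᵘ-inv b))
    (mkℚᵘ-mono-≤ _ _ _ _ (subst (c * suc b ≤_) (sym (ℕ.*-identityˡ (suc a))) cz≤x))))
  where
  toℚᵘ-product : ℚ.toℚᵘ ((+ c /ℚ 1) ℚ.* inv (suc a)) ≃ mkℚᵘ (+ c) a
  toℚᵘ-product = ℚᵘ.≃-trans (ℚ.toℚᵘ-homo-* (+ c /ℚ 1) (inv (suc a)))
    (ℚᵘ.≃-trans (ℚᵘ.*-cong (ℚ.toℚᵘ-fromℚᵘ (mkℚᵘ (+ c) 0)) (toℚᵘ-inv a))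
                (ℚᵘ.*≡* (ℤ.*-assoc (+ c) (+ 1) (+ suc a))))

p+q≤r⇒p≤r-q : ∀ p q r → p ℚ.+ q ≤ℚ r → p ≤ℚ r - q
p+q≤r⇒p≤r-q p q r p+q≤r = subst (_≤ℚ r - q) cancel (ℚ.+-monoˡ-≤ (ℚ.- q) p+q≤r)
  where
  open ≡-Reasoning
  cancel : p ℚ.+ q ℚ.+ ℚ.- q ≡ p
  cancel = begin
    p ℚ.+ q ℚ.+ ℚ.- q     ≡⟨ ℚ.+-assoc p q (ℚ.- q) ⟩
    p ℚ.+ (q ℚ.+ ℚ.- q)   ≡⟨ cong (p ℚ.+_) (ℚ.+-inverseʳ q) ⟩
    p ℚ.+ ℚ.0ℚ            ≡⟨ ℚ.+-identityʳ p ⟩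
    p                     ∎

inv≤inv[k*m]-inv[k*[m+1]] : ∀ k m N → 1 ≤ k → 1 ≤ m → k * m * (m + 1) ≤ N →
                           inv N ≤ℚ inv (k * m) - inv (k * (m + 1))
inv≤inv[k*m]-inv[k*[m+1]] k m N 1≤k 1≤m kmm'≤N =
  p+q≤r⇒p≤r-q _ _ _ (inv+inv≤inv N k′ (k * m) 1≤N 1≤k′ (ℕ.*-mono-≤ 1≤k 1≤m) cross)
  where
  open ℕ.≤-Reasoning
  k′ : ℕ
  k′ = k * (m + 1)
  1≤k′ : 1 ≤ k′
  1≤k′ = ℕ.*-mono-≤ 1≤k (ℕ.m≤n+m 1 m)
  1≤N : 1 ≤ N
  1≤N = ℕ.≤-trans (ℕ.*-mono-≤ (ℕ.*-mono-≤ 1≤k 1≤m) (ℕ.m≤n+m 1 m)) kmm'≤N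
  expandˡ : ∀ N k m → (N + k * (m + 1)) * (k * m) ≡ N * (k * m) + k * (k * m * (m + 1))
  expandˡ = solve-∀
  expandʳ : ∀ N k m → N * (k * m) + N * k ≡ N * (k * (m + 1))
  expandʳ = solve-∀
  cross : (N + k′) * (k * m) ≤ N * k′
  cross = begin
    (N + k′) * (k * m)                  ≡⟨ expandˡ N k m ⟩
    N * (k * m) + k * (k * m * (m + 1)) ≤⟨ ℕ.+-monoʳ-≤ (N * (k * m)) (ℕ.*-monoʳ-≤ k kmm'≤N) ⟩
    N * (k * m) + k * N                 ≡⟨ cong (_+_ (N * (k * m))) (ℕ.*-comm k N) ⟩
    N * (k * m) + N * k                 ≡⟨ expandʳ N k m ⟩
    N * k′                              ∎

sumFin-mono-≤ : ∀ n (f g : Fin n → ℚ) → (∀ i → f i ≤ℚ g i) → sumFin n f ≤ℚ sumFin n g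
sumFin-mono-≤ zero    f g f≤g = ℚ.≤-refl
sumFin-mono-≤ (suc n) f g f≤g = ℚ.+-mono-≤ (f≤g Fin.zero)
  (sumFin-mono-≤ n (λ i → f (Fin.suc i)) (λ i → g (Fin.suc i)) (λ i → f≤g (Fin.suc i)))

sumFin-*ˡ : ∀ n c (f : Fin n → ℚ) → sumFin n (λ i → c ℚ.* f i) ≡ c ℚ.* sumFin n f
sumFin-*ˡ zero    c f = sym (ℚ.*-zeroʳ c)
sumFin-*ˡ (suc n) c f = begin
  c ℚ.* f₀ ℚ.+ sumFin n (λ i → c ℚ.* fₛ i) ≡⟨ cong (c ℚ.* f₀ ℚ.+_) (sumFin-*ˡ n c fₛ) ⟩
  c ℚ.* f₀ ℚ.+ c ℚ.* sumFin n fₛ           ≡⟨ ℚ.*-distribˡ-+ c f₀ (sumFin n fₛ) ⟨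
  c ℚ.* sumFin (suc n) f                   ∎
  where
  open ≡-Reasoning
  f₀ : ℚ
  f₀ = f Fin.zero
  fₛ : Fin n → ℚ
  fₛ i = f (Fin.suc i)

lemma6p1 : (n k : ℕ) (m : Fin (suc n) → ℕ) → 2 ≤ k → (∀ i → 2 ≤ m i)
    → 1ℚ < sumFin (suc n) (λ i → inv (2 * s0 (k * m i)))
    → (∀ i → inv (2 * s0 (k * m i)) ≤ℚ (inv (k * m i) - inv (k * (m i + 1))))
    × ((+ 3) /ℚ 1 < sumFin (suc n) (λ i → inv (k * m i)))
lemma6p1 n k m 2≤k 2≤m 1<Σ = gap , 3<Σ
  where
  1≤k : 1 ≤ k
  1≤k = ℕ.≤-trans (s≤s z≤n) 2≤k
  1≤m : ∀ i → 1 ≤ m i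
  1≤m i = ℕ.≤-trans (s≤s z≤n) (2≤m i)
  1≤km : ∀ i → 1 ≤ k * m i
  1≤km i = ℕ.*-mono-≤ 1≤k (1≤m i)
  bound : ∀ i → k * m i * (m i + 1) ≤ 2 * s0 (k * m i)
  bound i = k*m*[m+1]≤2*s0[k*m] k (m i) 2≤k (2≤m i)
  3km≤bound : ∀ i → 3 * (k * m i) ≤ 2 * s0 (k * m i)
  3km≤bound i = ℕ.≤-trans (ℕ.≤-reflexive (ℕ.*-comm 3 (k * m i)))
    (ℕ.≤-trans (ℕ.*-monoʳ-≤ (k * m i) (ℕ.+-monoˡ-≤ 1 (2≤m i))) (bound i))
  1≤bound : ∀ i → 1 ≤ 2 * s0 (k * m i)
  1≤bound i = ℕ.≤-trans (1≤km i) (ℕ.≤-trans (ℕ.m≤n*m _ 3) (3km≤bound i))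

  gap : ∀ i → inv (2 * s0 (k * m i)) ≤ℚ inv (k * m i) - inv (k * (m i + 1))
  gap i = inv≤inv[k*m]-inv[k*[m+1]] k (m i) _ 1≤k (1≤m i) (bound i)

  three : ℚ
  three = + 3 /ℚ 1
  f g : Fin (suc n) → ℚ
  f i = inv (2 * s0 (k * m i))
  g i = inv (k * m i)
  3<Σ : three < sumFin (suc n) g
  3<Σ = begin-strict
    three ℚ.* 1ℚ                          <⟨ ℚ.*-monoʳ-<-pos three 1<Σ ⟩
    three ℚ.* sumFin (suc n) f            ≡⟨ sumFin-*ˡ (suc n) three f ⟨
    sumFin (suc n) (λ i → three ℚ.* f i)  ≤⟨ sumFin-mono-≤ (suc n) _ g (λ i →
                                               c*inv≤inv 3 _ _ (1≤bound i) (1≤km i) (3km≤bound i)) ⟩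
    sumFin (suc n) g                      ∎
    where open ℚ.≤-Reasoning
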